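{- Let $q$ be an odd prime power. Then the quadrinomial $$f(X)=-X^2+2X^{q^2+1}+X^{2q}-X^{2q^2}\in\mathbb{F}_q[X]$$ is planar over $\mathbb{F}_{q^3}$.
   Context: For $q$ odd, a function $f:\mathbb{F}_{q^n}\to\mathbb{F}_{q^n}$ is called planar (over $\mathbb{F}_{q^n}$) if for every $\epsilon\in\mathbb{F}_{q^n}^*$ the polynomial $f(X+\epsilon)-f(X)$ induces a permutation of $\mathbb{F}_{q^n}$. -}

module Defs where

open import Level using (Level; _⊔_)
open import Data.Nat using (ℕ; zero; suc) renaming (_+_ to _+ℕ_; _*_ to _*ℕ_; _^_ to _^ℕ_)
open import Data.Nat.Primality using (Prime)
open import Data.Fin using (Fin)
open import Data.Product using (Σ; ∃; _×_; _,_)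
open import Relation.Binary.PropositionalEquality using (_≡_)
open import Relation.Nullary using (¬_)
open import Algebra.Bundles using (CommutativeRing)

IsPrimePower : ℕ → Set
IsPrimePower q = Σ ℕ λ p → Σ ℕ λ k → Prime p × (q ≡ p ^ℕ suc k)

Odd : ℕ → Set
Odd q = Σ ℕ λ m → q ≡ suc (2 *ℕ m)

record Field (c ℓ : Level) : Set (Level.suc (c ⊔ ℓ)) where
  field
    commutativeRing : CommutativeRing c ℓ
  open CommutativeRing commutativeRing public
  field
    1≉0     : ¬ (1# ≈ 0#)
    inverse : ∀ x → ¬ (x ≈ 0#) → ∃ λ y → (x * y) ≈ 1#

module _ {c ℓ : Level} (K : Field c ℓ) where
  open Field K

  pow : Carrier → ℕ → Carrier
  pow x zero    = 1#
  pow x (suc n) = x * pow x n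

  HasCardinality : ℕ → Set (c ⊔ ℓ)
  HasCardinality n = Σ (Fin n → Carrier) λ e →
    (∀ i j → e i ≈ e j → i ≡ j) × (∀ x → ∃ λ i → e i ≈ x)

  -- g : K → K induces a permutation of K (bijective w.r.t. ≈; g respects ≈ automatically
  -- for the polynomial maps considered here)
  IsPermutation : (Carrier → Carrier) → Set (c ⊔ ℓ)
  IsPermutation g = (∀ x y → g x ≈ g y → x ≈ y) × (∀ y → ∃ λ x → g x ≈ y)

  Planar : (Carrier → Carrier) → Set (c ⊔ ℓ)
  Planar f = ∀ ε → ¬ (ε ≈ 0#) → IsPermutation (λ x → f (x + ε) - f x)

  quadrinomial : ℕ → Carrier → Carrier
  quadrinomial q x =
    ((- pow x 2) + ((1# + 1#) * pow x (q ^ℕ 2 +ℕ 1)) + pow x (2 *ℕ q)) - pow x (2 *ℕ q ^ℕ 2)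

-- Let σ x = x ^ q. On the field with q³ elements σ is additive (q is a power of the
-- characteristic), multiplicative, and σ³ = id. The quadrinomial is f x = Q (x, σ x, σ² x)
-- for the quadratic form Q (u, v, w) = - u² + 2 u w + v² - w², so with B the polar form of Q
--   (f (x + ε) - f x) - (f (y + ε) - f y) = 2 B ((ε, σ ε, σ² ε), (u, σ u, σ² u)),  u = x - y.
-- If this vanishes, applying σ and σ² gives three linear equations in u, σ u, σ² u whose
-- determinant is the product of the cyclic sums ε + σ² ε - σ ε, σ² ε + σ ε - ε, σ ε + ε - σ² ε.
-- None vanishes: a sum s = a + σ² a - σ a satisfies s + σ s = 2 a, and 2 ≠ 0 as q is odd.
-- Hence u = 0: the ε-difference of f is injective, and so bijective on the finite field.
module Submission where

open import Defs
open import Level using (Level)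
open import Algebra.Bundles using (CommutativeRing; CommutativeSemiring; CommutativeMonoid)
open import Data.Nat as ℕ using (ℕ; zero; suc; _<_; _∸_; _!; NonZero; z≤n; s≤s)
import Data.Nat.Properties as ℕ
open import Data.Nat.Divisibility using (_∣_; divides; m∣m*n; ∣1⇒≡1; ∣⇒≤)
open import Data.Nat.Primality using (Prime; euclidsLemma; ¬prime[1]; prime⇒nonZero)
open import Data.Nat.Combinatorics using (_C_; nCn≡1; k![n∸k]!∣n!)
open import Data.Nat.Combinatorics.Specification using (nCk≡n!/k![n-k]!)
open import Data.Nat.DivMod using (m/n*n≡m)
open import Data.Integer as ℤ using (ℤ; +_; -[1+_]; _⊖_)
import Data.Integer.Properties as ℤ
open import Data.Fin as Fin using (Fin; toℕ; fromℕ)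
import Data.Fin.Properties as Fin
open import Data.Fin.Permutation using (Permutation; permutation)
open import Data.Vec.Functional using (init; last; tail)
open import Data.Maybe using (Maybe; just; nothing)
open import Data.Product using (∃; _,_; proj₁; proj₂)
open import Data.Sum using (inj₁; inj₂)
open import Function using (_∘_)
open import Function.Definitions using (Injective)
open import Relation.Binary.Bundles using (Setoid)
open import Relation.Binary.Definitions using (Decidable)
open import Relation.Nullary using (¬_; yes; no; contradiction)
import Relation.Nullary.Decidable as Dec
open import Relation.Binary.PropositionalEquality as ≡ using (_≡_; _≢_)

-- Tactic.RingSolver takes its coefficients from R itself, so in an abstract ring it
-- cannot see that 1# - 1# vanishes; here the coefficients are integers instead.
module IntegerCoefficientSolver {c ℓ : Level} (R : CommutativeRing c ℓ) where
  open CommutativeRing R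
  open import Algebra.Properties.Ring ring using (-‿distribˡ-*; -‿distribʳ-*)
  open import Algebra.Properties.AbelianGroup +-abelianGroup using (⁻¹-∙-comm; ε⁻¹≈ε; ⁻¹-involutive)
  open import Algebra.Properties.Semiring.Mult.TCOptimised semiring using (_×_; 1+×; ×-homo-+; ×1-homo-*)
  open import Algebra.Solver.Ring.AlmostCommutativeRing using (fromCommutativeRing; _-Raw-AlmostCommutative⟶_)
  open import Relation.Binary.Reasoning.Setoid setoid

  -- With the optimised _×_, ⟦ + 2 ⟧ℤ reduces to the 1# + 1# of the quadrinomial.
  ⟦_⟧ℤ : ℤ → Carrier
  ⟦ + n ⟧ℤ      = n × 1#
  ⟦ -[1+ n ] ⟧ℤ = - (suc n × 1#)

  ⊖-homo : ∀ m n → ⟦ m ⊖ n ⟧ℤ ≈ m × 1# - n × 1#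
  ⊖-homo zero    zero    = sym (-‿inverseʳ 0#)
  ⊖-homo (suc m) zero    = sym (trans (+-congˡ ε⁻¹≈ε) (+-identityʳ _))
  ⊖-homo zero    (suc n) = sym (+-identityˡ _)
  ⊖-homo (suc m) (suc n) = begin
    ⟦ suc m ⊖ suc n ⟧ℤ                 ≡⟨ ≡.cong ⟦_⟧ℤ (ℤ.[1+m]⊖[1+n]≡m⊖n m n) ⟩
    ⟦ m ⊖ n ⟧ℤ                         ≈⟨ ⊖-homo m n ⟩
    m × 1# - n × 1#                    ≈⟨ +-identityˡ _ ⟨
    0# + (m × 1# - n × 1#)             ≈⟨ +-congʳ (-‿inverseʳ 1#) ⟨
    (1# - 1#) + (m × 1# - n × 1#)      ≈⟨ +-interchange 1# (- 1#) (m × 1#) (- (n × 1#)) ⟩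
    (1# + m × 1#) + (- 1# - n × 1#)    ≈⟨ +-cong (sym (1+× m 1#)) (trans (⁻¹-∙-comm 1# _) (-‿cong (sym (1+× n 1#)))) ⟩
    suc m × 1# - suc n × 1#            ∎
    where open import Algebra.Properties.CommutativeSemigroup +-commutativeSemigroup
            using () renaming (interchange to +-interchange)

  -‿homo : ∀ i → ⟦ ℤ.- i ⟧ℤ ≈ - ⟦ i ⟧ℤ
  -‿homo -[1+ n ]   = sym (⁻¹-involutive _)
  -‿homo (+ zero)   = sym ε⁻¹≈ε
  -‿homo (+ suc n)  = refl

  +-homo : ∀ i j → ⟦ i ℤ.+ j ⟧ℤ ≈ ⟦ i ⟧ℤ + ⟦ j ⟧ℤ
  +-homo -[1+ m ] -[1+ n ] = begin
    - (suc (suc (m ℕ.+ n)) × 1#)        ≡⟨ ≡.cong (λ k → - (k × 1#)) (ℕ.+-suc (suc m) n) ⟨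
    - ((suc m ℕ.+ suc n) × 1#)          ≈⟨ -‿cong (×-homo-+ 1# (suc m) (suc n)) ⟩
    - (suc m × 1# + suc n × 1#)         ≈⟨ ⁻¹-∙-comm _ _ ⟨
    - (suc m × 1#) + - (suc n × 1#)     ∎
  +-homo -[1+ m ] (+ n)    = trans (⊖-homo n (suc m)) (+-comm _ _)
  +-homo (+ m)    -[1+ n ] = ⊖-homo m (suc n)
  +-homo (+ m)    (+ n)    = ×-homo-+ 1# m n

  +*-homo : ∀ m j → ⟦ + m ℤ.* j ⟧ℤ ≈ m × 1# * ⟦ j ⟧ℤ
  +*-homo m (+ n)    = trans (reflexive (≡.cong ⟦_⟧ℤ (≡.sym (ℤ.pos-* m n)))) (×1-homo-* m n)
  +*-homo m -[1+ n ] = begin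
    ⟦ + m ℤ.* -[1+ n ] ⟧ℤ          ≡⟨ ≡.cong ⟦_⟧ℤ (ℤ.neg-distribʳ-* (+ m) (+ suc n)) ⟨
    ⟦ ℤ.- (+ m ℤ.* + suc n) ⟧ℤ     ≈⟨ -‿homo (+ m ℤ.* + suc n) ⟩
    - ⟦ + m ℤ.* + suc n ⟧ℤ         ≈⟨ -‿cong (+*-homo m (+ suc n)) ⟩
    - (m × 1# * suc n × 1#)        ≈⟨ -‿distribʳ-* _ _ ⟩
    m × 1# * - (suc n × 1#)        ∎

  *-homo : ∀ i j → ⟦ i ℤ.* j ⟧ℤ ≈ ⟦ i ⟧ℤ * ⟦ j ⟧ℤ
  *-homo (+ m)    j = +*-homo m j
  *-homo -[1+ m ] j = begin
    ⟦ -[1+ m ] ℤ.* j ⟧ℤ            ≡⟨ ≡.cong ⟦_⟧ℤ (ℤ.neg-distribˡ-* (+ suc m) j) ⟨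
    ⟦ ℤ.- (+ suc m ℤ.* j) ⟧ℤ       ≈⟨ -‿homo (+ suc m ℤ.* j) ⟩
    - ⟦ + suc m ℤ.* j ⟧ℤ           ≈⟨ -‿cong (+*-homo (suc m) j) ⟩
    - (suc m × 1# * ⟦ j ⟧ℤ)        ≈⟨ -‿distribˡ-* _ _ ⟩
    - (suc m × 1#) * ⟦ j ⟧ℤ        ∎

  ⟦⟧ℤ-morphism : CommutativeRing.rawRing ℤ.+-*-commutativeRing -Raw-AlmostCommutative⟶ fromCommutativeRing R
  ⟦⟧ℤ-morphism = record
    { ⟦_⟧    = ⟦_⟧ℤ
    ; +-homo = +-homo
    ; *-homo = *-homo
    ; -‿homo = -‿homo
    ; 0-homo = refl
    ; 1-homo = refl
    }

  ⟦⟧ℤ-≟ : ∀ i j → Maybe (⟦ i ⟧ℤ ≈ ⟦ j ⟧ℤ)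
  ⟦⟧ℤ-≟ i j with i ℤ.≟ j
  ... | yes ≡.refl = just refl
  ... | no _       = nothing

  open import Algebra.Solver.Ring (CommutativeRing.rawRing ℤ.+-*-commutativeRing)
    (fromCommutativeRing R) ⟦⟧ℤ-morphism ⟦⟧ℤ-≟ public

n∣n! : ∀ n → .{{NonZero n}} → n ∣ n !
n∣n! (suc n) = m∣m*n (n !)

binomial*factorials≡factorial : ∀ {n k} → k ℕ.≤ n → (n C k) ℕ.* (k ! ℕ.* (n ∸ k) !) ≡ n !
binomial*factorials≡factorial {n} {k} k≤n = ≡.trans
  (≡.cong (ℕ._* (k ! ℕ.* (n ∸ k) !)) (nCk≡n!/k![n-k]! k≤n))
  (m/n*n≡m {{k ℕ.!* (n ∸ k) !≢0}} (k![n∸k]!∣n! k≤n))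

prime∤! : ∀ {p} m → Prime p → m < p → ¬ p ∣ m !
prime∤! zero    p-prime m<p p∣1 = ¬prime[1] (≡.subst Prime (∣1⇒≡1 p∣1) p-prime)
prime∤! (suc m) p-prime m<p p∣m! with euclidsLemma (suc m) (m !) p-prime p∣m!
... | inj₁ p∣1+m = ℕ.<⇒≱ m<p (∣⇒≤ p∣1+m)
... | inj₂ p∣m!′ = prime∤! m p-prime (ℕ.<-trans (ℕ.n<1+n m) m<p) p∣m!′

prime∣binomial : ∀ {p k} → Prime p → 0 < k → k < p → p ∣ p C k
prime∣binomial {p} {k} p-prime 0<k k<p
  with euclidsLemma (p C k) (k ! ℕ.* (p ∸ k) !) p-prime p∣p!
  where
  instance
    p≢0 : NonZero p
    p≢0 = prime⇒nonZero p-prime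
  p∣p! : p ∣ (p C k) ℕ.* (k ! ℕ.* (p ∸ k) !)
  p∣p! = ≡.subst (p ∣_) (≡.sym (binomial*factorials≡factorial (ℕ.<⇒≤ k<p))) (n∣n! p)
... | inj₁ p∣pCk = p∣pCk
... | inj₂ p∣k![p∸k]! with euclidsLemma (k !) ((p ∸ k) !) p-prime p∣k![p∸k]!
...   | inj₁ p∣k!     = contradiction p∣k! (prime∤! k p-prime k<p)
...   | inj₂ p∣[p∸k]! = contradiction p∣[p∸k]! (prime∤! (p ∸ k) p-prime (ℕ.∸-monoʳ-< 0<k (ℕ.<⇒≤ k<p)))

module Frobenius {c ℓ : Level} (R : CommutativeSemiring c ℓ) where
  open CommutativeSemiring R
  open import Algebra.Properties.Semiring.Mult semiring using (_×_; ×-congʳ; ×-assoc-*; ×-assocˡ)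
  open import Algebra.Properties.Semiring.Exp semiring using (_^_; ^-congˡ; ^-assocʳ)
  open import Algebra.Properties.Monoid.Sum +-monoid using (sum; sum-init-last; sum-cong-≋; sum-replicate-zero)
  open import Algebra.Properties.CommutativeSemiring.Binomial R using (theorem; binomialTerm)
  open import Relation.Binary.Reasoning.Setoid setoid

  p×1≈0⇒p×x≈0 : ∀ {p} → p × 1# ≈ 0# → ∀ x → p × x ≈ 0#
  p×1≈0⇒p×x≈0 {p} char x = begin
    p × x           ≈⟨ ×-congʳ p (*-identityˡ x) ⟨
    p × (1# * x)    ≈⟨ ×-assoc-* p 1# x ⟨
    (p × 1#) * x    ≈⟨ *-congʳ char ⟩
    0# * x          ≈⟨ zeroˡ x ⟩
    0#              ∎

  [pCk]×x≈0 : ∀ {p k} → Prime p → p × 1# ≈ 0# → 0 < k → k < p → ∀ x → (p C k) × x ≈ 0#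
  [pCk]×x≈0 {p} {k} p-prime char 0<k k<p x with divides d pCk≡d*p ← prime∣binomial p-prime 0<k k<p = begin
    (p C k) × x     ≡⟨ ≡.cong (_× x) (≡.trans pCk≡d*p (ℕ.*-comm d p)) ⟩
    (p ℕ.* d) × x   ≈⟨ ×-assocˡ x p d ⟨
    p × (d × x)     ≈⟨ p×1≈0⇒p×x≈0 {p} char (d × x) ⟩
    0#              ∎

  inner-binomials≈0⇒^-distrib-+ : ∀ m x y → (∀ {k} → 0 < k → k < suc m → ∀ z → (suc m C k) × z ≈ 0#) →
                         (x + y) ^ suc m ≈ x ^ suc m + y ^ suc m
  inner-binomials≈0⇒^-distrib-+ m x y inner≈0 = begin
    (x + y) ^ suc m                                    ≈⟨ theorem (suc m) x y ⟩
    t Fin.zero + sum (tail t)                          ≈⟨ +-congˡ (sum-init-last (tail t)) ⟩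
    t Fin.zero + (sum (init (tail t)) + last (tail t)) ≈⟨ +-cong first (+-cong inner last≈x^) ⟩
    y ^ suc m + (0# + x ^ suc m)                       ≈⟨ +-congˡ (+-identityˡ _) ⟩
    y ^ suc m + x ^ suc m                              ≈⟨ +-comm _ _ ⟩
    x ^ suc m + y ^ suc m                              ∎
    where
    t : Fin (suc (suc m)) → Carrier
    t = binomialTerm x y (suc m)
    first : t Fin.zero ≈ y ^ suc m
    first = trans (+-identityʳ _) (*-identityˡ _)
    inner : sum (init (tail t)) ≈ 0#
    inner = trans (sum-cong-≋ λ j → inner≈0 (s≤s z≤n)
                    (s≤s (≡.subst (ℕ._< m) (≡.sym (Fin.toℕ-inject₁ j)) (Fin.toℕ<n j))) _)
                  (sum-replicate-zero m)
    last≈x^ : last (tail t) ≈ x ^ suc m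
    last≈x^ = begin
      (suc m C toℕ (fromℕ (suc m))) × (x ^ toℕ (fromℕ (suc m)) * y ^ (suc m ℕ.∸ toℕ (fromℕ (suc m))))
        ≡⟨ ≡.cong (λ k → (suc m C k) × (x ^ k * y ^ (suc m ℕ.∸ k))) (Fin.toℕ-fromℕ (suc m)) ⟩
      (suc m C suc m) × (x ^ suc m * y ^ (m ℕ.∸ m))
        ≡⟨ ≡.cong₂ (λ a b → a × (x ^ suc m * y ^ b)) (nCn≡1 (suc m)) (ℕ.n∸n≡0 m) ⟩
      1 × (x ^ suc m * 1#)   ≈⟨ trans (+-identityʳ _) (*-identityʳ _) ⟩
      x ^ suc m              ∎

  prime-^-distrib-+ : ∀ {p} → Prime p → p × 1# ≈ 0# → ∀ x y → (x + y) ^ p ≈ x ^ p + y ^ p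
  prime-^-distrib-+ {suc m} p-prime char x y = inner-binomials≈0⇒^-distrib-+ m x y ([pCk]×x≈0 p-prime char)

  primePower-^-distrib-+ : ∀ {p} → Prime p → p × 1# ≈ 0# →
                           ∀ r x y → (x + y) ^ (p ℕ.^ r) ≈ x ^ (p ℕ.^ r) + y ^ (p ℕ.^ r)
  primePower-^-distrib-+ {p} p-prime char zero    x y =
    trans (*-identityʳ _) (+-cong (sym (*-identityʳ x)) (sym (*-identityʳ y)))
  primePower-^-distrib-+ {p} p-prime char (suc r) x y = begin
    (x + y) ^ (p ℕ.* p ℕ.^ r)                  ≈⟨ ^-assocʳ (x + y) p (p ℕ.^ r) ⟨
    ((x + y) ^ p) ^ (p ℕ.^ r)                  ≈⟨ ^-congˡ (p ℕ.^ r) (prime-^-distrib-+ p-prime char x y) ⟩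
    (x ^ p + y ^ p) ^ (p ℕ.^ r)                ≈⟨ primePower-^-distrib-+ p-prime char r (x ^ p) (y ^ p) ⟩
    (x ^ p) ^ (p ℕ.^ r) + (y ^ p) ^ (p ℕ.^ r)  ≈⟨ +-cong (^-assocʳ x p _) (^-assocʳ y p _) ⟩
    x ^ (p ℕ.* p ℕ.^ r) + y ^ (p ℕ.* p ℕ.^ r)  ∎

Fin-injective⇒surjective : ∀ {m} {f : Fin m → Fin m} → Injective _≡_ _≡_ f → ∀ j → ∃ λ i → f i ≡ j
Fin-injective⇒surjective {suc m} {f} f-injective j with Fin.any? (λ i → f i Fin.≟ j)
... | yes hit = hit
... | no  miss = contradiction (Fin.injective⇒≤ f′-injective) ℕ.1+n≰n
  where
  j≢f : ∀ i → j ≢ f i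
  j≢f i j≡fi = miss (i , ≡.sym j≡fi)
  f′ : Fin (suc m) → Fin m
  f′ i = Fin.punchOut (j≢f i)
  f′-injective : Injective _≡_ _≡_ f′
  f′-injective {x} {y} = f-injective ∘ Fin.punchOut-injective (j≢f x) (j≢f y)

Fin-injective⇒permutation : ∀ {m} (f : Fin m → Fin m) → Injective _≡_ _≡_ f → Permutation m m
Fin-injective⇒permutation {m} f f-injective = permutation f f⁻¹
  (λ j → proj₂ (Fin-injective⇒surjective f-injective j))
  (λ i → f-injective (proj₂ (Fin-injective⇒surjective f-injective (f i))))
  where
  f⁻¹ : Fin m → Fin m
  f⁻¹ j = proj₁ (Fin-injective⇒surjective f-injective j)

module _ {a ℓ : Level} (S : Setoid a ℓ) where
  open Setoid S

  induced-injective : ∀ {m} {e : Fin m → Carrier} {g : Carrier → Carrier} {ĝ : Fin m → Fin m} →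
                      Injective _≡_ _≈_ e → Injective _≈_ _≈_ g → (∀ i → e (ĝ i) ≈ g (e i)) →
                      Injective _≡_ _≡_ ĝ
  induced-injective {e = e} e-injective g-injective e∘ĝ≈g∘e {i} {j} ĝi≡ĝj =
    e-injective (g-injective (trans (sym (e∘ĝ≈g∘e i)) (trans (reflexive (≡.cong e ĝi≡ĝj)) (e∘ĝ≈g∘e j))))

module _ {a ℓ : Level} (M : CommutativeMonoid a ℓ) where
  open CommutativeMonoid M
  open import Algebra.Properties.CommutativeMonoid.Sum M using (sum; sum-permute; ∑-distrib-+; sum-replicate; sum-cong-≋)
  open import Algebra.Properties.Monoid.Mult monoid using (_×_)
  open import Relation.Binary.Reasoning.Setoid setoid

  sum-translate : ∀ {m} {f : Fin m → Fin m} → Injective _≡_ _≡_ f →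
                  ∀ (e : Fin m → Carrier) x → (∀ i → e (f i) ≈ x ∙ e i) → m × x ∙ sum e ≈ sum e
  sum-translate {m} {f} f-injective e x e∘f≈x∙e = begin
    m × x ∙ sum e                ≈⟨ ∙-congʳ (sum-replicate m) ⟨
    sum {m} (λ _ → x) ∙ sum e    ≈⟨ ∑-distrib-+ (λ _ → x) e ⟨
    sum (λ i → x ∙ e i)          ≈⟨ sum-cong-≋ e∘f≈x∙e ⟨
    sum (e ∘ f)                  ≈⟨ sum-permute e (Fin-injective⇒permutation f f-injective) ⟨
    sum e                        ∎

module FieldProperties {c ℓ : Level} (K : Field c ℓ) where
  open Field K
  open import Algebra.Definitions _≈_ using (AlmostLeftCancellative)
  open import Algebra.Properties.Ring ring using (x[y-z]≈xy-xz)
  open import Algebra.Properties.AbelianGroup +-abelianGroup using (x∙y⁻¹≈ε⇒x≈y)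
  open import Algebra.Properties.CommutativeSemigroup *-commutativeSemigroup using (xy∙z≈y∙xz)
  open import Algebra.Properties.Semiring.Mult semiring using (_×_; ×1-homo-*)
  open import Algebra.Properties.Semiring.Exp semiring using (_^_)
  open import Algebra.Properties.CommutativeMonoid.Sum *-commutativeMonoid using () renaming (sum to product)
  open import Relation.Binary.Reasoning.Setoid setoid

  x≉0∧xy≈0⇒y≈0 : ∀ {x y} → x ≉ 0# → x * y ≈ 0# → y ≈ 0#
  x≉0∧xy≈0⇒y≈0 {x} {y} x≉0 xy≈0 with x⁻¹ , xx⁻¹≈1 ← inverse x x≉0 = begin
    y               ≈⟨ *-identityˡ y ⟨
    1# * y          ≈⟨ *-congʳ xx⁻¹≈1 ⟨
    x * x⁻¹ * y     ≈⟨ xy∙z≈y∙xz x x⁻¹ y ⟩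
    x⁻¹ * (x * y)   ≈⟨ *-congˡ xy≈0 ⟩
    x⁻¹ * 0#        ≈⟨ zeroʳ x⁻¹ ⟩
    0#              ∎

  *-≉0 : ∀ {x y} → x ≉ 0# → y ≉ 0# → x * y ≉ 0#
  *-≉0 x≉0 y≉0 xy≈0 = y≉0 (x≉0∧xy≈0⇒y≈0 x≉0 xy≈0)

  ^-≉0 : ∀ {x} n → x ≉ 0# → x ^ n ≉ 0#
  ^-≉0 zero    x≉0 = 1≉0
  ^-≉0 (suc n) x≉0 = *-≉0 x≉0 (^-≉0 n x≉0)

  product-≉0 : ∀ {m} (f : Fin m → Carrier) → (∀ i → f i ≉ 0#) → product f ≉ 0#
  product-≉0 {zero}  f f≉0 = 1≉0
  product-≉0 {suc m} f f≉0 = *-≉0 (f≉0 Fin.zero) (product-≉0 (f ∘ Fin.suc) (f≉0 ∘ Fin.suc))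

  ×1-homo-^ : ∀ m r → (m ℕ.^ r) × 1# ≈ (m × 1#) ^ r
  ×1-homo-^ m zero    = +-identityʳ 1#
  ×1-homo-^ m (suc r) = trans (×1-homo-* m (m ℕ.^ r)) (*-congˡ (×1-homo-^ m r))

  *-almostCancelˡ : AlmostLeftCancellative 0# _*_
  *-almostCancelˡ x y z x≉0 xy≈xz = x∙y⁻¹≈ε⇒x≈y y z (x≉0∧xy≈0⇒y≈0 x≉0 (begin
    x * (y - z)     ≈⟨ x[y-z]≈xy-xz x y z ⟩
    x * y - x * z   ≈⟨ +-congʳ xy≈xz ⟩
    x * z - x * z   ≈⟨ -‿inverseʳ (x * z) ⟩
    0#              ∎))

  odd×1≈0⇒2≉0 : ∀ m → suc (2 ℕ.* m) × 1# ≈ 0# → 1# + 1# ≉ 0#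
  odd×1≈0⇒2≉0 m [1+2m]×1≈0 2≈0 = 1≉0 (begin
    1#                          ≈⟨ +-identityʳ 1# ⟨
    1# + 0#                     ≈⟨ +-congˡ (zeroˡ (m × 1#)) ⟨
    1# + 0# * (m × 1#)          ≈⟨ +-congˡ (*-congʳ (trans (+-congˡ (+-identityʳ 1#)) 2≈0)) ⟨
    1# + (2 × 1#) * (m × 1#)    ≈⟨ +-congˡ (×1-homo-* 2 m) ⟨
    suc (2 ℕ.* m) × 1#          ≈⟨ [1+2m]×1≈0 ⟩
    0#                          ∎)

module FiniteField {c ℓ : Level} (K : Field c ℓ) {n : ℕ} (K-card : HasCardinality K (suc n)) where
  open Field K
  open FieldProperties K
  open import Algebra.Properties.AbelianGroup +-abelianGroup using (identityˡ-unique; ∙-cancelˡ)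
  open import Algebra.Properties.CommutativeMonoid.Sum *-commutativeMonoid using () renaming (sum to product)
  open import Algebra.Properties.CommutativeMonoid.Sum +-commutativeMonoid using (sum)
  open import Algebra.Properties.Semiring.Mult semiring using (_×_)
  open import Algebra.Properties.Semiring.Exp semiring using (_^_)
  open import Relation.Binary.Reasoning.Setoid setoid

  private
    enum : Fin (suc n) → Carrier
    enum = proj₁ K-card

    enum-injective : Injective _≡_ _≈_ enum
    enum-injective = proj₁ (proj₂ K-card) _ _

    index : Carrier → Fin (suc n)
    index x = proj₁ (proj₂ (proj₂ K-card) x)

    enum∘index : ∀ x → enum (index x) ≈ x
    enum∘index x = proj₂ (proj₂ (proj₂ K-card) x)

    lift : (Carrier → Carrier) → Fin (suc n) → Fin (suc n)
    lift g i = index (g (enum i))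

    lift-injective : ∀ {g} → Injective _≈_ _≈_ g → Injective _≡_ _≡_ (lift g)
    lift-injective g-injective = induced-injective setoid enum-injective g-injective (λ i → enum∘index _)

  _≟_ : Decidable _≈_
  x ≟ y = Dec.map′ index≡⇒≈ (λ x≈y → enum-injective (trans (enum∘index x) (trans x≈y (sym (enum∘index y)))))
                   (index x Fin.≟ index y)
    where
    index≡⇒≈ : index x ≡ index y → x ≈ y
    index≡⇒≈ eq = trans (sym (enum∘index x)) (trans (reflexive (≡.cong enum eq)) (enum∘index y))

  injective⇒surjective : ∀ {g} → Injective _≈_ _≈_ g → ∀ y → ∃ λ x → g x ≈ y
  injective⇒surjective {g} g-injective y with i , gi≡y ← Fin-injective⇒surjective (lift-injective g-injective) (index y) =
    enum i , trans (sym (enum∘index _)) (trans (reflexive (≡.cong enum gi≡y)) (enum∘index y))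

  cardinality×x≈0 : ∀ x → suc n × x ≈ 0#
  cardinality×x≈0 x = identityˡ-unique (suc n × x) (sum enum)
    (sum-translate +-commutativeMonoid (lift-injective (∙-cancelˡ x _ _)) enum x (λ i → enum∘index _))

  private
    zero-index : Fin (suc n)
    zero-index = index 0#

    unit : Fin n → Carrier
    unit j = enum (Fin.punchIn zero-index j)

    unit≉0 : ∀ j → unit j ≉ 0#
    unit≉0 j unit≈0 = Fin.punchInᵢ≢i zero-index j (enum-injective (trans unit≈0 (sym (enum∘index 0#))))

    unit-injective : Injective _≡_ _≈_ unit
    unit-injective = Fin.punchIn-injective zero-index _ _ ∘ enum-injective

    unit-index : ∀ y → y ≉ 0# → Fin n
    unit-index y y≉0 = Fin.punchOut {i = zero-index} {j = index y} λ 0≡y →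
      y≉0 (trans (sym (enum∘index y)) (trans (reflexive (≡.cong enum (≡.sym 0≡y))) (enum∘index 0#)))

    unit∘unit-index : ∀ y (y≉0 : y ≉ 0#) → unit (unit-index y y≉0) ≈ y
    unit∘unit-index y y≉0 = trans (reflexive (≡.cong enum (Fin.punchIn-punchOut _))) (enum∘index y)

  x^n≈1 : ∀ {x} → x ≉ 0# → x ^ n ≈ 1#
  x^n≈1 {x} x≉0 = *-almostCancelˡ (product unit) (x ^ n) 1# (product-≉0 unit unit≉0) (begin
    product unit * x ^ n   ≈⟨ *-comm _ _ ⟩
    x ^ n * product unit   ≈⟨ sum-translate *-commutativeMonoid translate-injective unit x unit∘translate ⟩
    product unit           ≈⟨ *-identityʳ _ ⟨
    product unit * 1#      ∎)
    where
    translate : Fin n → Fin n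
    translate j = unit-index (x * unit j) (*-≉0 x≉0 (unit≉0 j))
    unit∘translate : ∀ j → unit (translate j) ≈ x * unit j
    unit∘translate j = unit∘unit-index (x * unit j) (*-≉0 x≉0 (unit≉0 j))
    translate-injective : Injective _≡_ _≡_ translate
    translate-injective = induced-injective setoid unit-injective (λ {y} {z} → *-almostCancelˡ x y z x≉0) unit∘translate

  x^cardinality≈x : ∀ x → x ^ suc n ≈ x
  x^cardinality≈x x with x ≟ 0#
  ... | yes x≈0 = trans (*-congʳ x≈0) (trans (zeroˡ _) (sym x≈0))
  ... | no  x≉0 = trans (*-congˡ (x^n≈1 x≉0)) (*-identityʳ x)

  [m^r]×1≈0⇒m×1≈0 : ∀ m r → (m ℕ.^ r) × 1# ≈ 0# → m × 1# ≈ 0#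
  [m^r]×1≈0⇒m×1≈0 m r m^r×1≈0 = Dec.decidable-stable ((m × 1#) ≟ 0#) λ m×1≉0 →
    ^-≉0 r m×1≉0 (trans (sym (×1-homo-^ m r)) m^r×1≈0)

module QuadraticForm {c ℓ : Level} (R : CommutativeRing c ℓ) where
  open CommutativeRing R
  open IntegerCoefficientSolver R using (solve; _:=_; _:+_; _:*_; _:-_; :-_; con)

  Q : Carrier → Carrier → Carrier → Carrier
  Q u v w = ((- (u * u)) + (1# + 1#) * (w * u) + v * v) - w * w

  -- The polar form of Q: Q (X + A) - Q X - Q A = 2 B A X.
  B : Carrier → Carrier → Carrier → Carrier → Carrier → Carrier → Carrier
  B a b c u v w = (c - a) * (u - w) + b * v

  Q-cong : ∀ {u u′ v v′ w w′} → u ≈ u′ → v ≈ v′ → w ≈ w′ → Q u v w ≈ Q u′ v′ w′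
  Q-cong u≈ v≈ w≈ =
    +-cong (+-cong (+-cong (-‿cong (*-cong u≈ u≈)) (*-congˡ (*-cong w≈ u≈))) (*-cong v≈ v≈)) (-‿cong (*-cong w≈ w≈))

  Q-second-difference : ∀ a b c x X Y y X′ Y′ →
    (Q (x + a) (X + b) (Y + c) - Q x X Y) - (Q (y + a) (X′ + b) (Y′ + c) - Q y X′ Y′) ≈
    (1# + 1#) * B a b c (x - y) (X - X′) (Y - Y′)
  Q-second-difference = solve 9 (λ a b c x X Y y X′ Y′ →
    let Q′ u v w       = ((:- (u :* u)) :+ con (+ 2) :* (w :* u) :+ v :* v) :- w :* w
        B′ a b c u v w = (c :- a) :* (u :- w) :+ b :* v
    in (Q′ (x :+ a) (X :+ b) (Y :+ c) :- Q′ x X Y) :- (Q′ (y :+ a) (X′ :+ b) (Y′ :+ c) :- Q′ y X′ Y′)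
       := con (+ 2) :* B′ a b c (x :- y) (X :- X′) (Y :- Y′)) refl

  -- Cramer's rule for the cyclic system B a b c u v w = B b c a v w u = B c a b w u v = 0:
  -- the coefficients are the first row of its adjugate.
  B-cramer : ∀ a b c u v w →
    (a + c - b) * ((c + b - a) * (b + a - c)) * u ≈
    (b - c) * (a - b + c) * B a b c u v w - (b - c) * (b + a - c) * B b c a v w u + (b * c - (a - c) * (a - b)) * B c a b w u v
  B-cramer = solve 6 (λ a b c u v w →
    let B′ a b c u v w = (c :- a) :* (u :- w) :+ b :* v
    in (a :+ c :- b) :* ((c :+ b :- a) :* (b :+ a :- c)) :* u
       := (b :- c) :* (a :- b :+ c) :* B′ a b c u v w :- (b :- c) :* (b :+ a :- c) :* B′ b c a v w u
          :+ (b :* c :- (a :- c) :* (a :- b)) :* B′ c a b w u v) refl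

  cyclic-sum : ∀ a b c → (a + c - b) + (b + a - c) ≈ (1# + 1#) * a
  cyclic-sum = solve 3 (λ a b c → (a :+ c :- b) :+ (b :+ a :- c) := con (+ 2) :* a) refl

module _ {c ℓ : Level} (K : Field c ℓ) where
  open Field K

  module OrderThreeAutomorphism
    (σ : Carrier → Carrier) (σ-cong : ∀ {x y} → x ≈ y → σ x ≈ σ y)
    (σ-+ : ∀ x y → σ (x + y) ≈ σ x + σ y) (σ-* : ∀ x y → σ (x * y) ≈ σ x * σ y)
    (σ³≈id : ∀ x → σ (σ (σ x)) ≈ x) (2≉0 : 1# + 1# ≉ 0#) where

    open FieldProperties K
    open QuadraticForm commutativeRing
    open import Algebra.Properties.Ring ring using (x+x≈x⇒x≈0)
    open import Algebra.Properties.AbelianGroup +-abelianGroup using (inverseʳ-unique; x∙y⁻¹≈ε⇒x≈y; x≈y⇒x∙y⁻¹≈ε)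
    open import Relation.Binary.Reasoning.Setoid setoid

    σ-0 : σ 0# ≈ 0#
    σ-0 = x+x≈x⇒x≈0 (σ 0#) (trans (sym (σ-+ 0# 0#)) (σ-cong (+-identityˡ 0#)))

    σ-‿ : ∀ x → σ (- x) ≈ - σ x
    σ-‿ x = inverseʳ-unique (σ x) (σ (- x)) (trans (sym (σ-+ x (- x))) (trans (σ-cong (-‿inverseʳ x)) σ-0))

    σ-- : ∀ x y → σ (x - y) ≈ σ x - σ y
    σ-- x y = trans (σ-+ x (- y)) (+-congˡ (σ-‿ y))

    record Orbit (a b c : Carrier) : Set ℓ where
      field
        σa≈b : σ a ≈ b
        σb≈c : σ b ≈ c
        σc≈a : σ c ≈ a
    open Orbit

    orbit : ∀ x → Orbit x (σ x) (σ (σ x))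
    orbit x = record { σa≈b = refl ; σb≈c = refl ; σc≈a = σ³≈id x }

    rotate : ∀ {a b c} → Orbit a b c → Orbit b c a
    rotate o = record { σa≈b = σb≈c o ; σb≈c = σc≈a o ; σc≈a = σa≈b o }

    orbit-- : ∀ {a b c a′ b′ c′} → Orbit a b c → Orbit a′ b′ c′ → Orbit (a - a′) (b - b′) (c - c′)
    orbit-- o o′ = record
      { σa≈b = trans (σ-- _ _) (+-cong (σa≈b o) (-‿cong (σa≈b o′)))
      ; σb≈c = trans (σ-- _ _) (+-cong (σb≈c o) (-‿cong (σb≈c o′)))
      ; σc≈a = trans (σ-- _ _) (+-cong (σc≈a o) (-‿cong (σc≈a o′)))
      }

    orbit-≉0 : ∀ {a b c} → Orbit a b c → a ≉ 0# → b ≉ 0#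
    orbit-≉0 {a} {b} {c} o a≉0 b≈0 = a≉0 (begin
      a          ≈⟨ σc≈a o ⟨
      σ c        ≈⟨ σ-cong (σb≈c o) ⟨
      σ (σ b)    ≈⟨ σ-cong (σ-cong b≈0) ⟩
      σ (σ 0#)   ≈⟨ σ-cong σ-0 ⟩
      σ 0#       ≈⟨ σ-0 ⟩
      0#         ∎)

    -- Applying σ to a + c - b ≈ 0 gives b + a - c ≈ 0; the two add up to 2a.
    orbit-sum≉0 : ∀ {a b c} → Orbit a b c → a ≉ 0# → a + c - b ≉ 0#
    orbit-sum≉0 {a} {b} {c} o a≉0 s≈0 = a≉0 (x≉0∧xy≈0⇒y≈0 2≉0 (begin
      (1# + 1#) * a               ≈⟨ cyclic-sum a b c ⟨
      (a + c - b) + (b + a - c)   ≈⟨ +-cong s≈0 σs≈0 ⟩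
      0# + 0#                     ≈⟨ +-identityˡ 0# ⟩
      0#                          ∎))
      where
      σs≈0 : b + a - c ≈ 0#
      σs≈0 = begin
        b + a - c            ≈⟨ +-cong (+-cong (σa≈b o) (σc≈a o)) (-‿cong (σb≈c o)) ⟨
        σ a + σ c - σ b      ≈⟨ +-congʳ (σ-+ a c) ⟨
        σ (a + c) - σ b      ≈⟨ σ-- (a + c) b ⟨
        σ (a + c - b)        ≈⟨ σ-cong s≈0 ⟩
        σ 0#                 ≈⟨ σ-0 ⟩
        0#                   ∎

    B-rotate : ∀ {a b c u v w} → Orbit a b c → Orbit u v w → B a b c u v w ≈ 0# → B b c a v w u ≈ 0#
    B-rotate {a} {b} {c} {u} {v} {w} o o′ B≈0 = begin
      (a - b) * (v - u) + c * w
        ≈⟨ +-cong (*-cong (+-cong (σc≈a o) (-‿cong (σa≈b o))) (+-cong (σa≈b o′) (-‿cong (σc≈a o′))))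
                  (*-cong (σb≈c o) (σb≈c o′)) ⟨
      (σ c - σ a) * (σ u - σ w) + σ b * σ v   ≈⟨ +-cong (*-cong (σ-- c a) (σ-- u w)) (σ-* b v) ⟨
      σ (c - a) * σ (u - w) + σ (b * v)       ≈⟨ +-congʳ (σ-* (c - a) (u - w)) ⟨
      σ ((c - a) * (u - w)) + σ (b * v)       ≈⟨ σ-+ _ _ ⟨
      σ (B a b c u v w)                       ≈⟨ σ-cong B≈0 ⟩
      σ 0#                                    ≈⟨ σ-0 ⟩
      0#                                      ∎

    B-kernel : ∀ {a b c u v w} → Orbit a b c → Orbit u v w → a ≉ 0# → B a b c u v w ≈ 0# → u ≈ 0#
    B-kernel {a} {b} {c} {u} {v} {w} o o′ a≉0 B≈0 = x≉0∧xy≈0⇒y≈0 D≉0 (begin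
      D * u
        ≈⟨ B-cramer a b c u v w ⟩
      C₁ * B a b c u v w - C₂ * B b c a v w u + C₃ * B c a b w u v
        ≈⟨ +-cong (+-cong (*-congˡ B≈0) (-‿cong (*-congˡ B₁≈0))) (*-congˡ B₂≈0) ⟩
      C₁ * 0# - C₂ * 0# + C₃ * 0#
        ≈⟨ +-cong (+-cong (zeroʳ C₁) (-‿cong (zeroʳ C₂))) (zeroʳ C₃) ⟩
      0# - 0# + 0#
        ≈⟨ trans (+-identityʳ _) (-‿inverseʳ 0#) ⟩
      0# ∎)
      where
      D C₁ C₂ C₃ : Carrier
      D  = (a + c - b) * ((c + b - a) * (b + a - c))
      C₁ = (b - c) * (a - b + c)
      C₂ = (b - c) * (b + a - c)
      C₃ = b * c - (a - c) * (a - b)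
      b≉0 : b ≉ 0#
      b≉0 = orbit-≉0 o a≉0
      c≉0 : c ≉ 0#
      c≉0 = orbit-≉0 (rotate o) b≉0
      D≉0 : D ≉ 0#
      D≉0 = *-≉0 (orbit-sum≉0 o a≉0) (*-≉0 (orbit-sum≉0 (rotate (rotate o)) c≉0) (orbit-sum≉0 (rotate o) b≉0))
      B₁≈0 : B b c a v w u ≈ 0#
      B₁≈0 = B-rotate o o′ B≈0
      B₂≈0 : B c a b w u v ≈ 0#
      B₂≈0 = B-rotate (rotate o) (rotate o′) B₁≈0

    F : Carrier → Carrier
    F x = Q x (σ x) (σ (σ x))

    Δ-injective : ∀ {ε} → ε ≉ 0# → Injective _≈_ _≈_ (λ x → F (x + ε) - F x)
    Δ-injective {ε} ε≉0 {x} {y} Δx≈Δy = x∙y⁻¹≈ε⇒x≈y x y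
      (B-kernel (orbit ε) (orbit-- (orbit x) (orbit y)) ε≉0 (x≉0∧xy≈0⇒y≈0 2≉0 (begin
        (1# + 1#) * B ε (σ ε) (σ (σ ε)) (x - y) (σ x - σ y) (σ (σ x) - σ (σ y))
          ≈⟨ Q-second-difference ε (σ ε) (σ (σ ε)) x (σ x) (σ (σ x)) y (σ y) (σ (σ y)) ⟨
        (Q (x + ε) (σ x + σ ε) (σ (σ x) + σ (σ ε)) - F x) - (Q (y + ε) (σ y + σ ε) (σ (σ y) + σ (σ ε)) - F y)
          ≈⟨ +-cong (+-congʳ (F-+ x)) (-‿cong (+-congʳ (F-+ y))) ⟨
        (F (x + ε) - F x) - (F (y + ε) - F y)
          ≈⟨ x≈y⇒x∙y⁻¹≈ε Δx≈Δy ⟩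
        0# ∎)))
      where
      F-+ : ∀ z → F (z + ε) ≈ Q (z + ε) (σ z + σ ε) (σ (σ z) + σ (σ ε))
      F-+ z = Q-cong refl (σ-+ z ε) (trans (σ-cong (σ-+ z ε)) (σ-+ (σ z) (σ ε)))

module _ {c ℓ : Level} (K : Field c ℓ) where
  open Field K
  open QuadraticForm commutativeRing using (Q)
  open import Algebra.Properties.Semiring.Exp semiring using (_^_; ^-congˡ; ^-homo-*; ^-assocʳ)
  open import Relation.Binary.Reasoning.Setoid setoid

  pow≈^ : ∀ x n → pow K x n ≈ x ^ n
  pow≈^ x zero    = refl
  pow≈^ x (suc n) = *-congˡ (pow≈^ x n)

  ^-square : ∀ x q → x ^ (q ℕ.^ 2) ≈ (x ^ q) ^ q
  ^-square x q = sym (trans (^-assocʳ x q q) (reflexive (≡.cong (λ r → x ^ (q ℕ.* r)) (≡.sym (ℕ.*-identityʳ q)))))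

  ^-cube : ∀ x q → ((x ^ q) ^ q) ^ q ≈ x ^ (q ℕ.^ 3)
  ^-cube x q = begin
    ((x ^ q) ^ q) ^ q         ≈⟨ ^-congˡ q (sym (^-square x q)) ⟩
    (x ^ (q ℕ.^ 2)) ^ q       ≈⟨ ^-assocʳ x (q ℕ.^ 2) q ⟩
    x ^ (q ℕ.^ 2 ℕ.* q)       ≡⟨ ≡.cong (x ^_) (ℕ.*-comm (q ℕ.^ 2) q) ⟩
    x ^ (q ℕ.^ 3)             ∎

  pow-double : ∀ x n → pow K x (2 ℕ.* n) ≈ x ^ n * x ^ n
  pow-double x n = begin
    pow K x (n ℕ.+ (n ℕ.+ 0))  ≡⟨ ≡.cong (λ m → pow K x (n ℕ.+ m)) (ℕ.+-identityʳ n) ⟩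
    pow K x (n ℕ.+ n)          ≈⟨ pow≈^ x (n ℕ.+ n) ⟩
    x ^ (n ℕ.+ n)              ≈⟨ ^-homo-* x n n ⟩
    x ^ n * x ^ n              ∎

  quadrinomial≈Q : ∀ q x → quadrinomial K q x ≈ Q x (x ^ q) ((x ^ q) ^ q)
  quadrinomial≈Q q x = +-cong (+-cong (+-cong (-‿cong (*-congˡ (*-identityʳ x))) (*-congˡ x^[q²+1])) (pow-double x q))
                              (-‿cong (trans (pow-double x (q ℕ.^ 2)) (*-cong (^-square x q) (^-square x q))))
    where
    x^[q²+1] : pow K x (q ℕ.^ 2 ℕ.+ 1) ≈ (x ^ q) ^ q * x
    x^[q²+1] = begin
      pow K x (q ℕ.^ 2 ℕ.+ 1)     ≈⟨ pow≈^ x (q ℕ.^ 2 ℕ.+ 1) ⟩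
      x ^ (q ℕ.^ 2 ℕ.+ 1)         ≈⟨ ^-homo-* x (q ℕ.^ 2) 1 ⟩
      x ^ (q ℕ.^ 2) * x ^ 1       ≈⟨ *-cong (^-square x q) (*-identityʳ x) ⟩
      (x ^ q) ^ q * x             ∎

module CubicFrobenius {c ℓ : Level} (K : Field c ℓ) {n : ℕ} (K-card : HasCardinality K (suc n))
                      {q : ℕ} (q³≡1+n : q ℕ.^ 3 ≡ suc n)
                      {p k : ℕ} (p-prime : Prime p) (q≡p^[1+k] : q ≡ p ℕ.^ suc k) where
  open Field K
  open FiniteField K K-card
  open Frobenius commutativeSemiring using (primePower-^-distrib-+)
  open import Algebra.Properties.Semiring.Mult semiring using (_×_)
  open import Algebra.Properties.Semiring.Exp semiring using (_^_; ^-congˡ)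
  open import Algebra.Properties.CommutativeSemiring.Exp commutativeSemiring using (^-distrib-*)

  q×1≈0 : q × 1# ≈ 0#
  q×1≈0 = [m^r]×1≈0⇒m×1≈0 q 3 (≡.subst (λ r → r × 1# ≈ 0#) (≡.sym q³≡1+n) (cardinality×x≈0 1#))

  p×1≈0 : p × 1# ≈ 0#
  p×1≈0 = [m^r]×1≈0⇒m×1≈0 p (suc k) (≡.subst (λ r → r × 1# ≈ 0#) q≡p^[1+k] q×1≈0)

  frobenius : Carrier → Carrier
  frobenius x = x ^ q

  frobenius-cong : ∀ {x y} → x ≈ y → frobenius x ≈ frobenius y
  frobenius-cong = ^-congˡ q

  frobenius-+ : ∀ x y → frobenius (x + y) ≈ frobenius x + frobenius y
  frobenius-+ x y = ≡.subst (λ r → (x + y) ^ r ≈ x ^ r + y ^ r) (≡.sym q≡p^[1+k])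
    (primePower-^-distrib-+ p-prime p×1≈0 (suc k) x y)

  frobenius-* : ∀ x y → frobenius (x * y) ≈ frobenius x * frobenius y
  frobenius-* x y = ^-distrib-* x y q

  frobenius³≈id : ∀ x → frobenius (frobenius (frobenius x)) ≈ x
  frobenius³≈id x = trans (^-cube K x q) (trans (reflexive (≡.cong (x ^_) q³≡1+n)) (x^cardinality≈x x))

open import Data.Nat using (_^_)

-- Matching q against 1 + 2 m makes q ^ 3 reduce to a successor, the form FiniteField expects.
theorem3p2 : ∀ {c ℓ : Level} (q : ℕ) → IsPrimePower q → Odd q →
    (K : Field c ℓ) → HasCardinality K (q ^ 3) → Planar K (quadrinomial K q)
theorem3p2 q (p , k , p-prime , q≡p^[1+k]) (m , ≡.refl) K K-card ε ε≉0 =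
  (λ _ _ → quadrinomial-Δ-injective) , injective⇒surjective quadrinomial-Δ-injective
  where
  open Field K
  open FiniteField K K-card
  open CubicFrobenius K K-card ≡.refl {k = k} p-prime q≡p^[1+k]
  open OrderThreeAutomorphism K frobenius frobenius-cong frobenius-+ frobenius-* frobenius³≈id
    (FieldProperties.odd×1≈0⇒2≉0 K m q×1≈0)

  quadrinomial-Δ-injective : Injective _≈_ _≈_ (λ x → quadrinomial K q (x + ε) - quadrinomial K q x)
  quadrinomial-Δ-injective Δx≈Δy = Δ-injective ε≉0 (trans (sym (Δ≈ _)) (trans Δx≈Δy (Δ≈ _)))
    where
    Δ≈ : ∀ x → quadrinomial K q (x + ε) - quadrinomial K q x ≈ F (x + ε) - F x
    Δ≈ x = +-cong (quadrinomial≈Q K q (x + ε)) (-‿cong (quadrinomial≈Q K q x))
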